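{- Let $G$ be a finite bipartite graph with color classes $A$ and $B$, and let $b:V(G)\to\mathbb{Z}_{\ge0}$. Then the binary relation $\le_A$ is a partial order on the set $\mathcal{F}$ of all $b$-flexible components of $G$.
   Context: A $b$-matching is $M\subseteq E(G)$ with at most $b(v)$ edges of $M$ at each vertex $v$; maximum = largest cardinality. An edge is allowed if it lies in some maximum $b$-matching, forbidden otherwise; an allowed edge is inevitable if it lies in every maximum $b$-matching, flexible otherwise. Flexible components are the induced subgraphs $G[V(K)]$ for $K$ a connected component of the spanning subgraph $(V(G),\{\text{flexible edges}\})$; $\mathcal{F}$ is their set. For $C_1,C_2\in\mathcal{F}$ write $C_1\preceq^\circ_A C_2$ if $C_1=C_2$, or there is an inevitable edge joining a vertex of $V(C_1)\cap A$ to a vertex of $V(C_2)\cap B$, or a forbidden edge joining a vertex of $V(C_2)\cap A$ to a vertex of $V(C_1)\cap B$. Then $C_1\le_A C_2$ means there exist $D_1,\dots,D_k\in\mathcal{F}$ ($k\ge1$) with $D_1=C_1$, $D_k=C_2$ and $D_i\preceq^\circ_A D_{i+1}$ for each $i<k$. -}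

module Defs where

open import Data.Nat using (ℕ; zero; suc; _+_; _≤_)
open import Data.Bool using (Bool; true; false)
open import Data.Fin using (Fin; zero; suc)
open import Data.Sum using (_⊎_; inj₁; inj₂)
open import Data.Product using (Σ; _×_; _,_; ∃)
open import Data.Empty using (⊥)
open import Relation.Nullary using (¬_)
open import Relation.Binary.PropositionalEquality using (_≡_)
open import Relation.Binary.Construct.Closure.ReflexiveTransitive using (Star)

-- A finite bipartite (simple) graph with colour classes A = Fin p and
-- B = Fin q is given by its edge relation E : Fin p → Fin q → Bool;
-- (i , j) is an edge iff E i j ≡ true.

Vertex : ℕ → ℕ → Set
Vertex p q = Fin p ⊎ Fin q

count : ∀ {n} → (Fin n → Bool) → ℕ
count {zero}  f = zero
count {suc n} f with f zero
... | true  = suc (count (λ k → f (suc k)))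
... | false = count (λ k → f (suc k))

sumFin : ∀ {n} → (Fin n → ℕ) → ℕ
sumFin {zero}  f = zero
sumFin {suc n} f = f zero + sumFin (λ k → f (suc k))

EdgeSet : ℕ → ℕ → Set
EdgeSet p q = Fin p → Fin q → Bool

module _ {p q : ℕ} (E : EdgeSet p q) (b : Vertex p q → ℕ) where

  size : EdgeSet p q → ℕ
  size M = sumFin (λ i → count (M i))

  IsBMatching : EdgeSet p q → Set
  IsBMatching M =
    (∀ i j → M i j ≡ true → E i j ≡ true) ×
    (∀ i → count (M i) ≤ b (inj₁ i)) ×
    (∀ j → count (λ i → M i j) ≤ b (inj₂ j))

  IsMaxBMatching : EdgeSet p q → Set
  IsMaxBMatching M = IsBMatching M × (∀ M' → IsBMatching M' → size M' ≤ size M)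

  Allowed : Fin p → Fin q → Set
  Allowed i j = E i j ≡ true × ∃ λ M → IsMaxBMatching M × M i j ≡ true

  Forbidden : Fin p → Fin q → Set
  Forbidden i j = E i j ≡ true × ¬ Allowed i j

  Inevitable : Fin p → Fin q → Set
  Inevitable i j = Allowed i j × (∀ M → IsMaxBMatching M → M i j ≡ true)

  Flexible : Fin p → Fin q → Set
  Flexible i j = Allowed i j × ¬ Inevitable i j

  FlexAdj : Vertex p q → Vertex p q → Set
  FlexAdj (inj₁ i) (inj₂ j) = Flexible i j
  FlexAdj (inj₂ j) (inj₁ i) = Flexible i j
  FlexAdj (inj₁ _) (inj₁ _) = ⊥
  FlexAdj (inj₂ _) (inj₂ _) = ⊥

  -- u and v lie in the same flexible component.  The set 𝓕 of flexible
  -- components is the set of equivalence classes of vertices under SameComp.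
  SameComp : Vertex p q → Vertex p q → Set
  SameComp = Star FlexAdj

  -- C₁ ≼°_A C₂, with C₁ the component of u and C₂ the component of v
  StepA : Vertex p q → Vertex p q → Set
  StepA u v =
    SameComp u v ⊎
    (Σ (Fin p) λ i → Σ (Fin q) λ j →
       Inevitable i j × SameComp u (inj₁ i) × SameComp v (inj₂ j)) ⊎
    (Σ (Fin p) λ i → Σ (Fin q) λ j →
       Forbidden i j × SameComp v (inj₁ i) × SameComp u (inj₂ j))

  LeA : Vertex p q → Vertex p q → Set
  LeA = Star StepA

-- Fix a maximum b-matching M (one exists: augment along alternating paths until none is left)
-- and orient G, matched edges from A to B and unmatched ones from B to A. Order the vertices by
-- reachability in this digraph, with the vertices reaching a deficient A-vertex moved to the
-- bottom, those reachable from a deficient B-vertex to the top, and zero-capacity vertices at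
-- the extremes. Flipping M along alternating trails shows that an arc whose ends are related
-- backwards lies on a flip keeping M maximum, so it is flexible; conversely a König-type cover
-- argument shows that a flexible arc has its ends related backwards. Hence each flexible
-- component lies in one ⊑-class, while an inevitable or forbidden edge is a rigid arc and so a
-- strict ⊑-step between components: a ≤_A-chain either stays in one component or strictly rises.

module Submission where

open import Defs
open import Data.Nat using (ℕ; zero; suc; _+_; _*_; _≤_; _<_; z≤n; s≤s; z<s; _<?_)
open import Data.Nat.Properties
open import Data.Nat.Tactic.RingSolver using (solve-∀)
open import Algebra.Properties.CommutativeSemigroup +-commutativeSemigroup using (interchange)
open import Data.Bool using (Bool; true; false; not; _∧_; if_then_else_)
open import Data.Fin using (Fin; zero; suc) renaming (_≟_ to _≟ᶠ_)
open import Data.Fin.Properties using (any?) renaming (suc-injective to fin-suc-injective)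
open import Data.Sum using (_⊎_; inj₁; inj₂; [_,_])
open import Data.Sum.Properties using (≡-dec)
open import Data.Product using (Σ; ∃; _×_; _,_; proj₁; proj₂)
open import Data.Empty using (⊥; ⊥-elim)
open import Data.Unit using (⊤; tt)
open import Data.List using (List; []; _∷_; map; _++_; allFin)
open import Data.List.Membership.Propositional using (_∈_)
open import Data.List.Membership.Propositional.Properties using (∈-allFin; ∈-map⁺; ∈-++⁺ˡ; ∈-++⁺ʳ)
open import Data.List.Relation.Unary.Any using (here; there)
open import Relation.Nullary using (¬_; Dec; yes; no; does)
open import Relation.Nullary.Decidable using (dec-true; dec-false; _×-dec_; _⊎-dec_)
open import Relation.Binary.Definitions using (DecidableEquality)
open import Relation.Binary.PropositionalEquality
  using (_≡_; _≢_; refl; sym; trans; cong; cong₂; subst; module ≡-Reasoning)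
open import Relation.Binary.Construct.Closure.ReflexiveTransitive using (Star; ε; _◅_; _◅◅_; reverse)
open import Relation.Binary.Structures using (IsPartialOrder)

true≢false : true ≢ false
true≢false ()

swap-last : ∀ n a b c → n + (a + b) + c ≡ n + (a + c) + b
swap-last = solve-∀

⟦_⟧ : Bool → ℕ
⟦ true ⟧ = 1
⟦ false ⟧ = 0

sumFin-cong : ∀ {n} {f g : Fin n → ℕ} → (∀ k → f k ≡ g k) → sumFin f ≡ sumFin g
sumFin-cong {zero} f≡g = refl
sumFin-cong {suc n} f≡g = cong₂ _+_ (f≡g zero) (sumFin-cong (λ k → f≡g (suc k)))

sumFin-mono : ∀ {n} {f g : Fin n → ℕ} → (∀ k → f k ≤ g k) → sumFin f ≤ sumFin g
sumFin-mono {zero} f≤g = z≤n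
sumFin-mono {suc n} f≤g = +-mono-≤ (f≤g zero) (sumFin-mono (λ k → f≤g (suc k)))

sumFin-zero : ∀ {n} → sumFin {n} (λ _ → 0) ≡ 0
sumFin-zero {zero} = refl
sumFin-zero {suc n} = sumFin-zero {n}

sumFin-+ : ∀ {n} (f g : Fin n → ℕ) → sumFin (λ k → f k + g k) ≡ sumFin f + sumFin g
sumFin-+ {zero} f g = refl
sumFin-+ {suc n} f g rewrite sumFin-+ (λ k → f (suc k)) (λ k → g (suc k)) =
  interchange (f zero) (g zero) _ _

sumFin-*ˡ : ∀ {n} c (f : Fin n → ℕ) → sumFin (λ k → c * f k) ≡ c * sumFin f
sumFin-*ˡ {zero} c f = sym (*-zeroʳ c)
sumFin-*ˡ {suc n} c f rewrite sumFin-*ˡ c (λ k → f (suc k)) = sym (*-distribˡ-+ c (f zero) _)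

sumFin-swap : ∀ {m n} (g : Fin m → Fin n → ℕ) →
  sumFin (λ i → sumFin (λ j → g i j)) ≡ sumFin (λ j → sumFin (λ i → g i j))
sumFin-swap {zero} {n} g = sym (sumFin-zero {n})
sumFin-swap {suc m} g rewrite sumFin-swap (λ i j → g (suc i) j) =
  sym (sumFin-+ (λ j → g zero j) (λ j → sumFin (λ i → g (suc i) j)))

≤sumFin : ∀ {n} (f : Fin n → ℕ) k → f k ≤ sumFin f
≤sumFin f zero = m≤m+n _ _
≤sumFin f (suc k) = ≤-trans (≤sumFin (λ k → f (suc k)) k) (m≤n+m _ (f zero))

sumFin≤ : ∀ {n} c (f : Fin n → ℕ) → (∀ k → f k ≤ c) → sumFin f ≤ n * c
sumFin≤ {zero} c f f≤c = z≤n
sumFin≤ {suc n} c f f≤c = +-mono-≤ (f≤c zero) (sumFin≤ c (λ k → f (suc k)) (λ k → f≤c (suc k)))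

sumFin-differ-at : ∀ {n} (f g : Fin n → ℕ) k → (∀ m → m ≢ k → f m ≡ g m) →
  sumFin f + g k ≡ sumFin g + f k
sumFin-differ-at {suc n} f g zero f≡g =
  trans (cong (λ s → f zero + s + g zero) (sumFin-cong (λ m → f≡g (suc m) (λ ()))))
        (swap-ends (f zero) _ (g zero))
  where
  swap-ends : ∀ a s c → a + s + c ≡ c + s + a
  swap-ends = solve-∀
sumFin-differ-at {suc n} f g (suc k) f≡g = begin
  f zero + sumFin (λ m → f (suc m)) + g (suc k)   ≡⟨ +-assoc (f zero) _ _ ⟩
  f zero + (sumFin (λ m → f (suc m)) + g (suc k)) ≡⟨ cong₂ _+_ (f≡g zero (λ ())) rest ⟩
  g zero + (sumFin (λ m → g (suc m)) + f (suc k)) ≡⟨ +-assoc (g zero) _ _ ⟨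
  g zero + sumFin (λ m → g (suc m)) + f (suc k)   ∎
  where
  open ≡-Reasoning
  rest : sumFin (λ m → f (suc m)) + g (suc k) ≡ sumFin (λ m → g (suc m)) + f (suc k)
  rest = sumFin-differ-at (λ m → f (suc m)) (λ m → g (suc m)) k
           (λ m m≢k → f≡g (suc m) (λ e → m≢k (fin-suc-injective e)))

count≡sumFin : ∀ {n} (f : Fin n → Bool) → count f ≡ sumFin (λ k → ⟦ f k ⟧)
count≡sumFin {zero} f = refl
count≡sumFin {suc n} f with f zero
... | true = cong suc (count≡sumFin (λ k → f (suc k)))
... | false = count≡sumFin (λ k → f (suc k))

count-cong : ∀ {n} {f g : Fin n → Bool} → (∀ k → f k ≡ g k) → count f ≡ count g
count-cong {f = f} {g} f≡g = begin
  count f                   ≡⟨ count≡sumFin f ⟩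
  sumFin (λ k → ⟦ f k ⟧)   ≡⟨ sumFin-cong (λ k → cong ⟦_⟧ (f≡g k)) ⟩
  sumFin (λ k → ⟦ g k ⟧)   ≡⟨ count≡sumFin g ⟨
  count g                   ∎
  where open ≡-Reasoning

count-differ-at : ∀ {n} (f g : Fin n → Bool) k → (∀ m → m ≢ k → f m ≡ g m) →
  count f + ⟦ g k ⟧ ≡ count g + ⟦ f k ⟧
count-differ-at f g k f≡g = begin
  count f + ⟦ g k ⟧                  ≡⟨ cong (_+ ⟦ g k ⟧) (count≡sumFin f) ⟩
  sumFin (λ m → ⟦ f m ⟧) + ⟦ g k ⟧   ≡⟨ sumFin-differ-at _ _ k (λ m m≢k → cong ⟦_⟧ (f≡g m m≢k)) ⟩
  sumFin (λ m → ⟦ g m ⟧) + ⟦ f k ⟧   ≡⟨ cong (_+ ⟦ f k ⟧) (count≡sumFin g) ⟨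
  count g + ⟦ f k ⟧                  ∎
  where open ≡-Reasoning

count≤n : ∀ {n} (f : Fin n → Bool) → count f ≤ n
count≤n {zero} f = z≤n
count≤n {suc n} f with f zero
... | true = s≤s (count≤n (λ k → f (suc k)))
... | false = m≤n⇒m≤1+n (count≤n (λ k → f (suc k)))

count>0 : ∀ {n} (f : Fin n → Bool) k → f k ≡ true → 0 < count f
count>0 f k fk = begin-strict
  0                        <⟨ subst (λ b → 0 < ⟦ b ⟧) (sym fk) z<s ⟩
  ⟦ f k ⟧                  ≤⟨ ≤sumFin (λ m → ⟦ f m ⟧) k ⟩
  sumFin (λ m → ⟦ f m ⟧)   ≡⟨ count≡sumFin f ⟨
  count f                  ∎
  where open ≤-Reasoning

count>0⇒∃ : ∀ {n} (f : Fin n → Bool) → 0 < count f → ∃ λ k → f k ≡ true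
count>0⇒∃ {suc n} f count>0 with f zero in f0
... | true = zero , f0
... | false with count>0⇒∃ (λ k → f (suc k)) count>0
... | k , fk = suc k , fk

Σ² : ∀ {m n} → (Fin m → Fin n → ℕ) → ℕ
Σ² g = sumFin (λ i → sumFin (λ j → g i j))

Σ²-cong : ∀ {m n} {f g : Fin m → Fin n → ℕ} → (∀ i j → f i j ≡ g i j) → Σ² f ≡ Σ² g
Σ²-cong f≡g = sumFin-cong (λ i → sumFin-cong (f≡g i))

Σ²-mono : ∀ {m n} {f g : Fin m → Fin n → ℕ} → (∀ i j → f i j ≤ g i j) → Σ² f ≤ Σ² g
Σ²-mono f≤g = sumFin-mono (λ i → sumFin-mono (f≤g i))

Σ²-+ : ∀ {m n} (f g : Fin m → Fin n → ℕ) → Σ² (λ i j → f i j + g i j) ≡ Σ² f + Σ² g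
Σ²-+ f g = trans (sumFin-cong (λ i → sumFin-+ (f i) (g i)))
                 (sumFin-+ (λ i → sumFin (f i)) (λ i → sumFin (g i)))

≤Σ² : ∀ {m n} (g : Fin m → Fin n → ℕ) i j → g i j ≤ Σ² g
≤Σ² g i j = ≤-trans (≤sumFin (g i) j) (≤sumFin (λ i → sumFin (g i)) i)

-- Floyd–Warshall: `Via S x y` are the R-paths from x to y all of whose inner vertices lie in S;
-- deciding it by induction on S decides reachability once S lists every vertex.
module StarDecidable {X : Set} (_≟_ : DecidableEquality X) (R : X → X → Set)
  (R? : ∀ x y → Dec (R x y)) (xs : List X) (xs-complete : ∀ x → x ∈ xs) where

  data Via (S : List X) : X → X → Set where
    edge : ∀ {x y} → R x y → Via S x y
    _◅[_]_ : ∀ {x z y} → R x z → z ∈ S → Via S z y → Via S x y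

  Via[]⇒R : ∀ {x y} → Via [] x y → R x y
  Via[]⇒R (edge r) = r

  Via-weaken : ∀ {k S x y} → Via S x y → Via (k ∷ S) x y
  Via-weaken (edge r) = edge r
  Via-weaken (r ◅[ z∈S ] v) = r ◅[ there z∈S ] Via-weaken v

  Via-trans : ∀ {S x k y} → Via S x k → k ∈ S → Via S k y → Via S x y
  Via-trans (edge r) k∈S w = r ◅[ k∈S ] w
  Via-trans (r ◅[ z∈S ] v) k∈S w = r ◅[ z∈S ] Via-trans v k∈S w

  Via-join : ∀ {k S x y} → Via S x k → Via S k y → Via (k ∷ S) x y
  Via-join v w = Via-trans (Via-weaken v) (here refl) (Via-weaken w)

  Via-split : ∀ {k S x y} → Via (k ∷ S) x y → Via S x y ⊎ (Via S x k × Via S k y)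
  Via-split (edge r) = inj₁ (edge r)
  Via-split (r ◅[ here refl ] v) with Via-split v
  ... | inj₁ v′ = inj₂ (edge r , v′)
  ... | inj₂ (_ , w) = inj₂ (edge r , w)
  Via-split (r ◅[ there z∈S ] v) with Via-split v
  ... | inj₁ v′ = inj₁ (r ◅[ z∈S ] v′)
  ... | inj₂ (v′ , w) = inj₂ (r ◅[ z∈S ] v′ , w)

  Via? : ∀ S x y → Dec (Via S x y)
  Via? [] x y with R? x y
  ... | yes r = yes (edge r)
  ... | no ¬r = no (λ v → ¬r (Via[]⇒R v))
  Via? (k ∷ S) x y with Via? S x y | Via? S x k | Via? S k y
  ... | yes v | _ | _ = yes (Via-weaken v)
  ... | no _ | yes v | yes w = yes (Via-join v w)
  ... | no ¬v | no ¬v₁ | _ = no (λ u → [ ¬v , (λ vw → ¬v₁ (proj₁ vw)) ] (Via-split u))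
  ... | no ¬v | yes _ | no ¬v₂ = no (λ u → [ ¬v , (λ vw → ¬v₂ (proj₂ vw)) ] (Via-split u))

  Via⇒Star : ∀ {S x y} → Via S x y → Star R x y
  Via⇒Star (edge r) = r ◅ ε
  Via⇒Star (r ◅[ _ ] v) = r ◅ Via⇒Star v

  Star⇒Via : ∀ {x y} → Star R x y → x ≡ y ⊎ Via xs x y
  Star⇒Via ε = inj₁ refl
  Star⇒Via (r ◅ rs) with Star⇒Via rs
  ... | inj₁ refl = inj₂ (edge r)
  ... | inj₂ v = inj₂ (r ◅[ xs-complete _ ] v)

  Star? : ∀ x y → Dec (Star R x y)
  Star? x y with x ≟ y | Via? xs x y
  ... | yes refl | _ = yes ε
  ... | no _ | yes v = yes (Via⇒Star v)
  ... | no x≢y | no ¬v = no (λ rs → [ x≢y , ¬v ] (Star⇒Via rs))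

module _ {p q : ℕ} where

  _≟ᵛ_ : DecidableEquality (Vertex p q)
  _≟ᵛ_ = ≡-dec _≟ᶠ_ _≟ᶠ_

  allVertices : List (Vertex p q)
  allVertices = map inj₁ (allFin p) ++ map inj₂ (allFin q)

  ∈-allVertices : ∀ v → v ∈ allVertices
  ∈-allVertices (inj₁ i) = ∈-++⁺ˡ (∈-map⁺ inj₁ (∈-allFin i))
  ∈-allVertices (inj₂ j) = ∈-++⁺ʳ (map inj₁ (allFin p)) (∈-map⁺ inj₂ (∈-allFin j))

  anyVertex? : {P : Vertex p q → Set} → (∀ v → Dec (P v)) → Dec (∃ P)
  anyVertex? P? with any? (λ i → P? (inj₁ i)) | any? (λ j → P? (inj₂ j))
  ... | yes (i , Pi) | _ = yes (inj₁ i , Pi)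
  ... | no _ | yes (j , Pj) = yes (inj₂ j , Pj)
  ... | no ¬A | no ¬B = no λ { (inj₁ i , Pi) → ¬A (i , Pi) ; (inj₂ j , Pj) → ¬B (j , Pj) }

  δ : Vertex p q → Vertex p q → ℕ
  δ v w = ⟦ does (v ≟ᵛ w) ⟧

  deg : EdgeSet p q → Vertex p q → ℕ
  deg N (inj₁ i) = count (N i)
  deg N (inj₂ j) = count (λ i → N i j)

  -- Abstract, so that a `with` on i ≟ i₀ in the degree lemmas leaves `toggle` folded.
  abstract
    toggle : EdgeSet p q → Fin p → Fin q → EdgeSet p q
    toggle N i₀ j₀ i j = if does (i ≟ᶠ i₀) ∧ does (j ≟ᶠ j₀) then not (N i j) else N i j

    toggle-at : ∀ N i j → toggle N i j i j ≡ not (N i j)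
    toggle-at N i j rewrite dec-true (i ≟ᶠ i) refl | dec-true (j ≟ᶠ j) refl = refl

    toggle-elsewhere : ∀ N i₀ j₀ i j → ¬ (i ≡ i₀ × j ≡ j₀) → toggle N i₀ j₀ i j ≡ N i j
    toggle-elsewhere N i₀ j₀ i j ne with i ≟ᶠ i₀ | j ≟ᶠ j₀
    ... | yes refl | yes refl = ⊥-elim (ne (refl , refl))
    ... | yes _ | no _ = refl
    ... | no _ | _ = refl

    toggle-unchanged⊎at : ∀ N i₀ j₀ i j → toggle N i₀ j₀ i j ≡ N i j ⊎ (i ≡ i₀ × j ≡ j₀)
    toggle-unchanged⊎at N i₀ j₀ i j with i ≟ᶠ i₀ | j ≟ᶠ j₀
    ... | yes refl | yes refl = inj₂ (refl , refl)
    ... | yes _ | no _ = inj₁ refl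
    ... | no _ | _ = inj₁ refl

  toggle-row : ∀ N i₀ j₀ {b} → N i₀ j₀ ≡ b →
    count (toggle N i₀ j₀ i₀) + ⟦ b ⟧ ≡ count (N i₀) + ⟦ not b ⟧
  toggle-row N i₀ j₀ refl =
    trans (count-differ-at _ (N i₀) j₀
             (λ j j≢j₀ → toggle-elsewhere N i₀ j₀ i₀ j (λ e → j≢j₀ (proj₂ e))))
          (cong (λ b → count (N i₀) + ⟦ b ⟧) (toggle-at N i₀ j₀))

  toggle-column : ∀ N i₀ j₀ {b} → N i₀ j₀ ≡ b →
    count (λ i → toggle N i₀ j₀ i j₀) + ⟦ b ⟧ ≡ count (λ i → N i j₀) + ⟦ not b ⟧
  toggle-column N i₀ j₀ refl =
    trans (count-differ-at _ (λ i → N i j₀) i₀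
             (λ i i≢i₀ → toggle-elsewhere N i₀ j₀ i j₀ (λ e → i≢i₀ (proj₁ e))))
          (cong (λ b → count (λ i → N i j₀) + ⟦ b ⟧) (toggle-at N i₀ j₀))

  toggle-other-row : ∀ N i₀ j₀ {i} → i ≢ i₀ → count (toggle N i₀ j₀ i) ≡ count (N i)
  toggle-other-row N i₀ j₀ {i} i≢i₀ =
    count-cong (λ j → toggle-elsewhere N i₀ j₀ i j (λ e → i≢i₀ (proj₁ e)))

  toggle-other-column : ∀ N i₀ j₀ {j} → j ≢ j₀ → count (λ i → toggle N i₀ j₀ i j) ≡ count (λ i → N i j)
  toggle-other-column N i₀ j₀ {j} j≢j₀ =
    count-cong (λ i → toggle-elsewhere N i₀ j₀ i j (λ e → j≢j₀ (proj₂ e)))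

  touches : Fin p → Fin q → Vertex p q → ℕ
  touches i₀ j₀ v = δ v (inj₁ i₀) + δ v (inj₂ j₀)

  toggle-deg-remove : ∀ N {i₀ j₀} → N i₀ j₀ ≡ true →
    ∀ v → deg (toggle N i₀ j₀) v + touches i₀ j₀ v ≡ deg N v
  toggle-deg-remove N {i₀} {j₀} e (inj₁ i) with i ≟ᶠ i₀
  ... | yes refl = trans (toggle-row N i₀ j₀ e) (+-identityʳ _)
  ... | no i≢i₀ = trans (+-identityʳ _) (toggle-other-row N i₀ j₀ i≢i₀)
  toggle-deg-remove N {i₀} {j₀} e (inj₂ j) with j ≟ᶠ j₀
  ... | yes refl = trans (toggle-column N i₀ j₀ e) (+-identityʳ _)
  ... | no j≢j₀ = trans (+-identityʳ _) (toggle-other-column N i₀ j₀ j≢j₀)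

  toggle-deg-add : ∀ N {i₀ j₀} → N i₀ j₀ ≡ false →
    ∀ v → deg (toggle N i₀ j₀) v ≡ deg N v + touches i₀ j₀ v
  toggle-deg-add N {i₀} {j₀} e (inj₁ i) with i ≟ᶠ i₀
  ... | yes refl = trans (sym (+-identityʳ _)) (toggle-row N i₀ j₀ e)
  ... | no i≢i₀ = trans (toggle-other-row N i₀ j₀ i≢i₀) (sym (+-identityʳ _))
  toggle-deg-add N {i₀} {j₀} e (inj₂ j) with j ≟ᶠ j₀
  ... | yes refl = trans (sym (+-identityʳ _)) (toggle-column N i₀ j₀ e)
  ... | no j≢j₀ = trans (toggle-other-column N i₀ j₀ j≢j₀) (sym (+-identityʳ _))

  toggle-size : ∀ N i₀ j₀ {b} → N i₀ j₀ ≡ b →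
    sumFin (λ i → count (toggle N i₀ j₀ i)) + ⟦ b ⟧ ≡ sumFin (λ i → count (N i)) + ⟦ not b ⟧
  toggle-size N i₀ j₀ e = +-diff-trans {a = count (toggle N i₀ j₀ i₀)} {c = count (N i₀)}
    (sumFin-differ-at (λ i → count (toggle N i₀ j₀ i)) (λ i → count (N i)) i₀
      (λ i → toggle-other-row N i₀ j₀))
    (toggle-row N i₀ j₀ e)
    where
    +-diff-trans : ∀ {s s′ a c x y} → s + c ≡ s′ + a → a + x ≡ c + y → s + x ≡ s′ + y
    +-diff-trans {s} {s′} {a} {c} {x} {y} e₁ e₂ = +-cancelʳ-≡ c _ _ (begin
      s + x + c     ≡⟨ +-assoc s x c ⟩
      s + (x + c)   ≡⟨ cong (s +_) (+-comm x c) ⟩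
      s + (c + x)   ≡⟨ +-assoc s c x ⟨
      s + c + x     ≡⟨ cong (_+ x) e₁ ⟩
      s′ + a + x    ≡⟨ +-assoc s′ a x ⟩
      s′ + (a + x)  ≡⟨ cong (s′ +_) e₂ ⟩
      s′ + (c + y)  ≡⟨ cong (s′ +_) (+-comm c y) ⟩
      s′ + (y + c)  ≡⟨ +-assoc s′ y c ⟨
      s′ + y + c    ∎)
      where open ≡-Reasoning

module AlternatingDigraph {p q : ℕ} (E M : EdgeSet p q) where

  data Arc : Vertex p q → Vertex p q → Set where
    matched   : ∀ {i j} → E i j ≡ true → M i j ≡ true  → Arc (inj₁ i) (inj₂ j)
    unmatched : ∀ {i j} → E i j ≡ true → M i j ≡ false → Arc (inj₂ j) (inj₁ i)

  Reach : Vertex p q → Vertex p q → Set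
  Reach = Star Arc

  arcA : ∀ {u v} → Arc u v → Fin p
  arcA (matched {i} _ _) = i
  arcA (unmatched {i} _ _) = i

  arcB : ∀ {u v} → Arc u v → Fin q
  arcB (matched {j = j} _ _) = j
  arcB (unmatched {j = j} _ _) = j

  arc-edge : ∀ {u v} (a : Arc u v) → E (arcA a) (arcB a) ≡ true
  arc-edge (matched e _) = e
  arc-edge (unmatched e _) = e

  arc? : ∀ u v → Dec (Arc u v)
  arc? (inj₁ i) (inj₂ j) with E i j in eE | M i j in eM
  ... | true | true = yes (matched eE eM)
  ... | true | false = no λ { (matched _ m) → true≢false (trans (sym m) eM) }
  ... | false | _ = no λ { (matched e _) → true≢false (trans (sym e) eE) }
  arc? (inj₂ j) (inj₁ i) with E i j in eE | M i j in eM
  ... | true | false = yes (unmatched eE eM)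
  ... | true | true = no λ { (unmatched _ m) → true≢false (trans (sym eM) m) }
  ... | false | _ = no λ { (unmatched e _) → true≢false (trans (sym e) eE) }
  arc? (inj₁ _) (inj₁ _) = no λ ()
  arc? (inj₂ _) (inj₂ _) = no λ ()

  open StarDecidable _≟ᵛ_ Arc arc? allVertices ∈-allVertices public
    using () renaming (Star? to Reach?)

  data Trail : Vertex p q → Vertex p q → Set
  Uses : ∀ {x y} → Fin p → Fin q → Trail x y → Set

  data Trail where
    [] : ∀ {x} → Trail x x
    cons : ∀ {x y z} (a : Arc x y) (T : Trail y z) → ¬ Uses (arcA a) (arcB a) T → Trail x z

  Uses i j [] = ⊥
  Uses i j (cons a T _) = (i ≡ arcA a × j ≡ arcB a) ⊎ Uses i j T

  flip : ∀ {x y} → Trail x y → EdgeSet p q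
  flip [] = M
  flip (cons a T _) = toggle (flip T) (arcA a) (arcB a)

  flip-unused : ∀ {x y} (T : Trail x y) {i j} → ¬ Uses i j T → flip T i j ≡ M i j
  flip-unused [] _ = refl
  flip-unused (cons a T _) {i} {j} ¬u =
    trans (toggle-elsewhere (flip T) _ _ i j (λ e → ¬u (inj₁ e))) (flip-unused T (λ u → ¬u (inj₂ u)))

  flip-used : ∀ {x y} (T : Trail x y) {i j} → Uses i j T → flip T i j ≡ not (M i j)
  flip-used (cons a T fresh) (inj₁ (refl , refl)) =
    trans (toggle-at (flip T) _ _) (cong not (flip-unused T fresh))
  flip-used (cons a T fresh) {i} {j} (inj₂ u) =
    trans (toggle-elsewhere (flip T) _ _ i j (λ { (refl , refl) → fresh u })) (flip-used T u)

  flip-⊆ : (∀ i j → M i j ≡ true → E i j ≡ true) →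
    ∀ {x y} (T : Trail x y) i j → flip T i j ≡ true → E i j ≡ true
  flip-⊆ M⊆E [] = M⊆E
  flip-⊆ M⊆E (cons a T _) i j fij with toggle-unchanged⊎at (flip T) (arcA a) (arcB a) i j
  ... | inj₁ unchanged = flip-⊆ M⊆E T i j (trans (sym unchanged) fij)
  ... | inj₂ (refl , refl) = arc-edge a

  -- Only the ends of a trail change degree: the start loses one if it lies in A and gains
  -- one if it lies in B, the end the other way round.
  δA δB : Vertex p q → Vertex p q → ℕ
  δA (inj₁ i) v = δ v (inj₁ i)
  δA (inj₂ _) v = 0
  δB (inj₁ _) v = 0
  δB (inj₂ j) v = δ v (inj₂ j)

  inA : Vertex p q → ℕ
  inA (inj₁ _) = 1
  inA (inj₂ _) = 0

  flip-deg : ∀ {x y} (T : Trail x y) v → deg (flip T) v + (δA x v + δB y v) ≡ deg M v + (δB x v + δA y v)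
  flip-deg {x} [] v = cong (deg M v +_) (+-comm (δA x v) (δB x v))
  flip-deg {y = y} (cons (matched {i} {j} _ m) T fresh) v = +-cancelʳ-≡ dⱼ _ _ (begin
    deg (toggle N i j) v + (dᵢ + δB y v) + dⱼ  ≡⟨ swap-last (deg (toggle N i j) v) dᵢ (δB y v) dⱼ ⟩
    deg (toggle N i j) v + (dᵢ + dⱼ) + δB y v  ≡⟨ cong (_+ δB y v) (toggle-deg-remove N (trans N≡M m) v) ⟩
    deg N v + δB y v                          ≡⟨ flip-deg T v ⟩
    deg M v + (dⱼ + δA y v)                   ≡⟨ cong (deg M v +_) (+-comm dⱼ (δA y v)) ⟩
    deg M v + (δA y v + dⱼ)                   ≡⟨ +-assoc (deg M v) (δA y v) dⱼ ⟨
    deg M v + δA y v + dⱼ                     ∎)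
    where
    open ≡-Reasoning
    N : EdgeSet p q
    N = flip T
    N≡M : N i j ≡ M i j
    N≡M = flip-unused T fresh
    dᵢ dⱼ : ℕ
    dᵢ = δ v (inj₁ i)
    dⱼ = δ v (inj₂ j)
  flip-deg {y = y} (cons (unmatched {i} {j} _ m) T fresh) v = begin
    deg (toggle N i j) v + δB y v             ≡⟨ cong (_+ δB y v) (toggle-deg-add N (trans N≡M m) v) ⟩
    deg N v + (dᵢ + dⱼ) + δB y v              ≡⟨ swap-last (deg N v) dᵢ dⱼ (δB y v) ⟩
    deg N v + (dᵢ + δB y v) + dⱼ              ≡⟨ cong (_+ dⱼ) (flip-deg T v) ⟩
    deg M v + δA y v + dⱼ                     ≡⟨ +-assoc (deg M v) (δA y v) dⱼ ⟩
    deg M v + (δA y v + dⱼ)                   ≡⟨ cong (deg M v +_) (+-comm (δA y v) dⱼ) ⟩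
    deg M v + (dⱼ + δA y v)                   ∎
    where
    open ≡-Reasoning
    N : EdgeSet p q
    N = flip T
    N≡M : N i j ≡ M i j
    N≡M = flip-unused T fresh
    dᵢ dⱼ : ℕ
    dᵢ = δ v (inj₁ i)
    dⱼ = δ v (inj₂ j)

  flip-size : ∀ {x y} (T : Trail x y) →
    sumFin (λ i → count (flip T i)) + inA x ≡ sumFin (λ i → count (M i)) + inA y
  flip-size [] = refl
  flip-size (cons a@(matched _ m) T fresh) =
    trans (toggle-size (flip T) (arcA a) (arcB a) (trans (flip-unused T fresh) m)) (flip-size T)
  flip-size (cons a@(unmatched _ m) T fresh) =
    trans (toggle-size (flip T) (arcA a) (arcB a) (trans (flip-unused T fresh) m)) (flip-size T)

  _∈ᵛ_ : ∀ {x y} → Vertex p q → Trail x y → Set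
  v ∈ᵛ ([] {x}) = v ≡ x
  v ∈ᵛ (cons {x} _ T _) = v ≡ x ⊎ v ∈ᵛ T

  _∈ᵛ?_ : ∀ {x y} v (T : Trail x y) → Dec (v ∈ᵛ T)
  v ∈ᵛ? ([] {x}) = v ≟ᵛ x
  v ∈ᵛ? (cons {x} _ T _) with v ≟ᵛ x | v ∈ᵛ? T
  ... | yes v≡x | _ = yes (inj₁ v≡x)
  ... | no _ | yes v∈T = yes (inj₂ v∈T)
  ... | no v≢x | no v∉T = no [ v≢x , v∉T ]

  start∈ᵛ : ∀ {x y} (T : Trail x y) → x ∈ᵛ T
  start∈ᵛ [] = refl
  start∈ᵛ (cons _ _ _) = inj₁ refl

  end∈ᵛ : ∀ {x y} (T : Trail x y) → y ∈ᵛ T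
  end∈ᵛ [] = refl
  end∈ᵛ (cons _ T _) = inj₂ (end∈ᵛ T)

  uses⇒∈ᵛ : ∀ {x y} (T : Trail x y) {i j} → Uses i j T → inj₁ i ∈ᵛ T × inj₂ j ∈ᵛ T
  uses⇒∈ᵛ (cons (matched _ _) T _) (inj₁ (refl , refl)) = inj₁ refl , inj₂ (start∈ᵛ T)
  uses⇒∈ᵛ (cons (unmatched _ _) T _) (inj₁ (refl , refl)) = inj₂ (start∈ᵛ T) , inj₁ refl
  uses⇒∈ᵛ (cons _ T _) (inj₂ u) with uses⇒∈ᵛ T u
  ... | i∈T , j∈T = inj₂ i∈T , inj₂ j∈T

  fresh-arc : ∀ {x y z} (a : Arc x y) (T : Trail y z) → ¬ x ∈ᵛ T → ¬ Uses (arcA a) (arcB a) T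
  fresh-arc (matched _ _) T x∉T u = x∉T (proj₁ (uses⇒∈ᵛ T u))
  fresh-arc (unmatched _ _) T x∉T u = x∉T (proj₂ (uses⇒∈ᵛ T u))

  toReach : ∀ {x y} → Trail x y → Reach x y
  toReach [] = ε
  toReach (cons a T _) = a ◅ toReach T

  reach-∈ᵛ : ∀ {x y v} (T : Trail x y) → v ∈ᵛ T → Reach x v
  reach-∈ᵛ [] refl = ε
  reach-∈ᵛ (cons _ _ _) (inj₁ refl) = ε
  reach-∈ᵛ (cons a T _) (inj₂ v∈T) = a ◅ reach-∈ᵛ T v∈T

  ∈ᵛ-reach : ∀ {x y v} (T : Trail x y) → v ∈ᵛ T → Reach v y
  ∈ᵛ-reach [] refl = ε
  ∈ᵛ-reach T@(cons _ _ _) (inj₁ refl) = toReach T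
  ∈ᵛ-reach (cons _ T _) (inj₂ v∈T) = ∈ᵛ-reach T v∈T

  Simple : ∀ {x y} → Trail x y → Set
  Simple [] = ⊤
  Simple (cons {x} _ T _) = ¬ x ∈ᵛ T × Simple T

  SimpleTrail : Vertex p q → Vertex p q → Set
  SimpleTrail x y = Σ (Trail x y) Simple

  suffix : ∀ {x y v} (T : Trail x y) → Simple T → v ∈ᵛ T → SimpleTrail v y
  suffix [] _ refl = [] , tt
  suffix T@(cons _ _ _) simple (inj₁ refl) = T , simple
  suffix (cons _ T _) (_ , simple) (inj₂ v∈T) = suffix T simple v∈T

  simplify : ∀ {x y} → Reach x y → SimpleTrail x y
  simplify ε = [] , tt
  simplify {x} (a ◅ r) with simplify r
  ... | T , simple with x ∈ᵛ? T
  ... | yes x∈T = suffix T simple x∈T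
  ... | no x∉T = cons a T (fresh-arc a T x∉T) , x∉T , simple

  used⇒arc-not-from-end : ∀ {x y} (T : Trail x y) → Simple T → ∀ {i j} → Uses i j T →
    Σ (Vertex p q) λ u → Σ (Vertex p q) λ u′ → Σ (Arc u u′) λ a → arcA a ≡ i × arcB a ≡ j × u ≢ y
  used⇒arc-not-from-end (cons {x} a T _) (x∉T , _) (inj₁ (refl , refl)) =
    x , _ , a , refl , refl , λ { refl → x∉T (end∈ᵛ T) }
  used⇒arc-not-from-end (cons _ T _) (_ , simple) (inj₂ u) = used⇒arc-not-from-end T simple u

  -- An edge of P with the same ends as the closing arc is traversed in the same direction
  -- (the direction is fixed by M), hence would leave from w, the end of P.
  closing-arc-fresh : ∀ {w z} (a : Arc w z) (P : Trail z w) → Simple P → ¬ Uses (arcA a) (arcB a) P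
  closing-arc-fresh a P simple u with used⇒arc-not-from-end P simple u
  closing-arc-fresh (matched _ _) P _ _ | _ , _ , matched _ _ , refl , refl , u≢w = u≢w refl
  closing-arc-fresh (matched _ m) P _ _ | _ , _ , unmatched _ m′ , refl , refl , _ = true≢false (trans (sym m) m′)
  closing-arc-fresh (unmatched _ m) P _ _ | _ , _ , matched _ m′ , refl , refl , _ = true≢false (trans (sym m′) m)
  closing-arc-fresh (unmatched _ _) P _ _ | _ , _ , unmatched _ _ , refl , refl , u≢w = u≢w refl

  Disjoint : ∀ {x y z w} → Trail x y → Trail z w → Set
  Disjoint T T′ = ∀ {i j} → Uses i j T → ¬ Uses i j T′

  _++_∣_ : ∀ {x y z} (T : Trail x y) (T′ : Trail y z) → Disjoint T T′ → Trail x z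
  uses-++ : ∀ {x y z} (T : Trail x y) (T′ : Trail y z) (disj : Disjoint T T′) →
    ∀ {i j} → Uses i j (T ++ T′ ∣ disj) → Uses i j T ⊎ Uses i j T′

  [] ++ T′ ∣ _ = T′
  cons a T fresh ++ T′ ∣ disj =
    cons a (T ++ T′ ∣ (λ u → disj (inj₂ u)))
      (λ u → [ fresh , disj (inj₁ (refl , refl)) ] (uses-++ T T′ (λ u → disj (inj₂ u)) u))

  uses-++ [] T′ _ u = inj₂ u
  uses-++ (cons _ _ _) T′ _ (inj₁ e) = inj₁ (inj₁ e)
  uses-++ (cons _ T _) T′ disj (inj₂ u) with uses-++ T T′ (λ u → disj (inj₂ u)) u
  ... | inj₁ u′ = inj₁ (inj₂ u′)
  ... | inj₂ u′ = inj₂ u′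

  uses-++ʳ : ∀ {x y z} (T : Trail x y) (T′ : Trail y z) (disj : Disjoint T T′) →
    ∀ {i j} → Uses i j T′ → Uses i j (T ++ T′ ∣ disj)
  uses-++ʳ [] T′ _ u = u
  uses-++ʳ (cons _ T _) T′ disj u = inj₂ (uses-++ʳ T T′ (λ u → disj (inj₂ u)) u)

bmatching-edge⇒capacities>0 : ∀ {p q} {E : EdgeSet p q} {b N} → IsBMatching E b N →
  ∀ {i j} → N i j ≡ true → 0 < b (inj₁ i) × 0 < b (inj₂ j)
bmatching-edge⇒capacities>0 {N = N} (_ , degA≤ , degB≤) {i} {j} e =
  <-≤-trans (count>0 (N i) j e) (degA≤ i) , <-≤-trans (count>0 (λ k → N k j) i e) (degB≤ j)

allowed⇒capacities>0 : ∀ {p q} {E : EdgeSet p q} {b i j} → Allowed E b i j → 0 < b (inj₁ i) × 0 < b (inj₂ j)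
allowed⇒capacities>0 {b = b} (_ , _ , (N-bmatching , _) , eN) = bmatching-edge⇒capacities>0 {b = b} N-bmatching eN

module WithBMatching {p q : ℕ} (E : EdgeSet p q) (b : Vertex p q → ℕ) (M : EdgeSet p q)
  (M-bmatching : IsBMatching E b M) where

  open AlternatingDigraph E M public

  M⊆E : ∀ i j → M i j ≡ true → E i j ≡ true
  M⊆E = proj₁ M-bmatching

  deg≤b : ∀ v → deg M v ≤ b v
  deg≤b (inj₁ i) = proj₁ (proj₂ M-bmatching) i
  deg≤b (inj₂ j) = proj₂ (proj₂ M-bmatching) j

  Deficient : Vertex p q → Set
  Deficient v = deg M v < b v

  DeficientA DeficientB : Vertex p q → Set
  DeficientA (inj₁ i) = Deficient (inj₁ i)
  DeficientA (inj₂ _) = ⊥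
  DeficientB (inj₁ _) = ⊥
  DeficientB (inj₂ j) = Deficient (inj₂ j)

  FromDeficientB ToDeficientA : Vertex p q → Set
  FromDeficientB v = ∃ λ x → DeficientB x × Reach x v
  ToDeficientA v = ∃ λ y → DeficientA y × Reach v y

  AugmentingPath : Set
  AugmentingPath = ∃ λ v → FromDeficientB v × ToDeficientA v

  deficientA? : ∀ v → Dec (DeficientA v)
  deficientA? (inj₁ i) = deg M (inj₁ i) <? b (inj₁ i)
  deficientA? (inj₂ _) = no λ ()

  deficientB? : ∀ v → Dec (DeficientB v)
  deficientB? (inj₁ _) = no λ ()
  deficientB? (inj₂ j) = deg M (inj₂ j) <? b (inj₂ j)

  fromDeficientB? : ∀ v → Dec (FromDeficientB v)
  fromDeficientB? v = anyVertex? (λ x → deficientB? x ×-dec Reach? x v)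

  toDeficientA? : ∀ v → Dec (ToDeficientA v)
  toDeficientA? v = anyVertex? (λ y → deficientA? y ×-dec Reach? v y)

  augmentingPath? : Dec AugmentingPath
  augmentingPath? = anyVertex? (λ v → fromDeficientB? v ×-dec toDeficientA? v)

  -- Admissible ends of a trail to flip: where flipping raises the degree, there must be room.
  Source Sink : Vertex p q → Set
  Source (inj₁ _) = ⊤
  Source (inj₂ j) = Deficient (inj₂ j)
  Sink (inj₁ i) = Deficient (inj₁ i)
  Sink (inj₂ _) = ⊤

  deficient-room : ∀ w → Deficient w → ∀ v → deg M v + δ v w ≤ b v
  deficient-room w w-deficient v with v ≟ᵛ w
  ... | yes refl = subst (_≤ b v) (+-comm 1 (deg M v)) w-deficient
  ... | no _ = subst (_≤ b v) (sym (+-identityʳ _)) (deg≤b v)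

  endpoint-room : ∀ x y → Source x → Sink y → ∀ v → deg M v + (δB x v + δA y v) ≤ b v
  endpoint-room (inj₁ _) (inj₁ i) _ i-deficient v = deficient-room (inj₁ i) i-deficient v
  endpoint-room (inj₁ _) (inj₂ _) _ _ v = subst (_≤ b v) (sym (+-identityʳ _)) (deg≤b v)
  endpoint-room (inj₂ j) (inj₂ _) j-deficient _ v =
    subst (λ n → deg M v + n ≤ b v) (sym (+-identityʳ _)) (deficient-room (inj₂ j) j-deficient v)
  endpoint-room (inj₂ j) (inj₁ i) _ i-deficient (inj₁ i′) = deficient-room (inj₁ i) i-deficient (inj₁ i′)
  endpoint-room (inj₂ j) (inj₁ i) j-deficient _ (inj₂ j′) =
    subst (λ n → deg M (inj₂ j′) + n ≤ b (inj₂ j′)) (sym (+-identityʳ _))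
          (deficient-room (inj₂ j) j-deficient (inj₂ j′))

  flip-bmatching : ∀ {x y} (T : Trail x y) → x ≡ y ⊎ (Source x × Sink y) → IsBMatching E b (flip T)
  flip-bmatching {x} {y} T ends = flip-⊆ M⊆E T , (λ i → deg-flip≤b (inj₁ i)) , (λ j → deg-flip≤b (inj₂ j))
    where
    before≤after : ∀ v → deg M v + (δB x v + δA y v) ≤ b v + (δA x v + δB y v)
    before≤after v = [ (λ { refl → +-mono-≤ (deg≤b v) (≤-reflexive (+-comm (δB x v) (δA x v))) })
                     , (λ { (source , sink) → ≤-trans (endpoint-room x y source sink v) (m≤m+n _ _) }) ] ends
    deg-flip≤b : ∀ v → deg (flip T) v ≤ b v
    deg-flip≤b v = +-cancelʳ-≤ (δA x v + δB y v) _ _ (begin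
      deg (flip T) v + (δA x v + δB y v)  ≡⟨ flip-deg T v ⟩
      deg M v + (δB x v + δA y v)         ≤⟨ before≤after v ⟩
      b v + (δA x v + δB y v)             ∎)
      where open ≤-Reasoning

  augment : AugmentingPath → ∃ λ N → IsBMatching E b N × size E b M < size E b N
  augment (_ , (inj₂ j , j-deficient , x⇝v) , (inj₁ i , i-deficient , v⇝y)) =
    flip T , flip-bmatching T (inj₂ (j-deficient , i-deficient)) ,
    subst (_≤ size E b (flip T)) (+-comm (size E b M) 1)
      (≤-reflexive (trans (sym (flip-size T)) (+-identityʳ _)))
    where
    T : Trail (inj₂ j) (inj₁ i)
    T = proj₁ (simplify (x⇝v ◅◅ v⇝y))

  -- König-type bound: as S is closed under arcs, (A ∩ S) ∪ (B ∖ S) covers every edge except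
  -- the matched ones from A ∖ S to B ∩ S, and by saturation M meets this cover tightly.
  module Cover (S : Vertex p q → Set) (S? : ∀ v → Dec (S v))
    (S-closed : ∀ {u v} → Arc u v → S u → S v)
    (A-saturated : ∀ i → S (inj₁ i) → b (inj₁ i) ≤ deg M (inj₁ i))
    (B-saturated : ∀ j → ¬ S (inj₂ j) → b (inj₂ j) ≤ deg M (inj₂ j)) where

    inS : Vertex p q → Bool
    inS v = does (S? v)

    wA : Fin p → ℕ
    wA i = ⟦ inS (inj₁ i) ⟧

    wB : Fin q → ℕ
    wB j = ⟦ not (inS (inj₂ j)) ⟧

    uncovered : Fin p → Fin q → ℕ
    uncovered i j = ⟦ M i j ∧ not (inS (inj₁ i)) ∧ inS (inj₂ j) ⟧

    doubly-covered : EdgeSet p q → Fin p → Fin q → ℕ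
    doubly-covered N i j = ⟦ N i j ∧ inS (inj₁ i) ∧ not (inS (inj₂ j)) ⟧

    uncovered-missed : EdgeSet p q → Fin p → Fin q → ℕ
    uncovered-missed N i j = ⟦ M i j ∧ not (inS (inj₁ i)) ∧ inS (inj₂ j) ∧ not (N i j) ⟧

    weight : EdgeSet p q → Fin p → Fin q → ℕ
    weight N i j = wA i * ⟦ N i j ⟧ + wB j * ⟦ N i j ⟧ + uncovered i j

    edge≤weight : ∀ N → (∀ i j → N i j ≡ true → E i j ≡ true) →
      ∀ i j → ⟦ N i j ⟧ + doubly-covered N i j + uncovered-missed N i j ≤ weight N i j
    edge≤weight N N⊆E i j with N i j in eN | M i j in eM | S? (inj₁ i) | S? (inj₂ j)
    ... | true  | true  | yes _ | yes _ = s≤s z≤n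
    ... | true  | true  | yes _ | no _  = ≤-refl
    ... | true  | true  | no _  | yes _ = s≤s z≤n
    ... | true  | true  | no _  | no _  = ≤-refl
    ... | true  | false | yes _ | yes _ = s≤s z≤n
    ... | true  | false | yes _ | no _  = ≤-refl
    ... | true  | false | no i∉S | yes j∈S = ⊥-elim (i∉S (S-closed (unmatched (N⊆E i j eN) eM) j∈S))
    ... | true  | false | no _  | no _  = ≤-refl
    ... | false | true  | yes _ | yes _ = z≤n
    ... | false | true  | yes _ | no _  = z≤n
    ... | false | true  | no _  | yes _ = ≤-refl
    ... | false | true  | no _  | no _  = z≤n
    ... | false | false | _     | _     = z≤n

    M-weight : ∀ i j → ⟦ M i j ⟧ ≡ weight M i j
    M-weight i j with M i j in eM | S? (inj₁ i) | S? (inj₂ j)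
    ... | true  | yes i∈S | no j∉S = ⊥-elim (j∉S (S-closed (matched (M⊆E i j eM) eM) i∈S))
    ... | true  | yes _ | yes _ = refl
    ... | true  | no _  | yes _ = refl
    ... | true  | no _  | no _  = refl
    ... | false | yes _ | yes _ = refl
    ... | false | yes _ | no _  = refl
    ... | false | no _  | yes _ = refl
    ... | false | no _  | no _  = refl

    size≡Σ² : ∀ N → size E b N ≡ Σ² (λ i j → ⟦ N i j ⟧)
    size≡Σ² N = sumFin-cong (λ i → count≡sumFin (N i))

    Σ²-weight : ∀ N → Σ² (weight N) ≡
      sumFin (λ i → wA i * deg N (inj₁ i)) + sumFin (λ j → wB j * deg N (inj₂ j)) + Σ² uncovered
    Σ²-weight N =
      trans (Σ²-+ (λ i j → wA i * ⟦ N i j ⟧ + wB j * ⟦ N i j ⟧) uncovered)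
            (cong (_+ Σ² uncovered) (trans (Σ²-+ (λ i j → wA i * ⟦ N i j ⟧) (λ i j → wB j * ⟦ N i j ⟧))
                                           (cong₂ _+_ rows columns)))
      where
      rows : Σ² (λ i j → wA i * ⟦ N i j ⟧) ≡ sumFin (λ i → wA i * deg N (inj₁ i))
      rows = sumFin-cong λ i →
        trans (sumFin-*ˡ (wA i) (λ j → ⟦ N i j ⟧)) (cong (wA i *_) (sym (count≡sumFin (N i))))
      columns : Σ² (λ i j → wB j * ⟦ N i j ⟧) ≡ sumFin (λ j → wB j * deg N (inj₂ j))
      columns = trans (sumFin-swap (λ i j → wB j * ⟦ N i j ⟧))
        (sumFin-cong λ j →
          trans (sumFin-*ˡ (wB j) (λ i → ⟦ N i j ⟧)) (cong (wB j *_) (sym (count≡sumFin (λ i → N i j)))))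

    capacity : ℕ
    capacity = sumFin (λ i → wA i * b (inj₁ i)) + sumFin (λ j → wB j * b (inj₂ j)) + Σ² uncovered

    M-size : size E b M ≡ capacity
    M-size = begin
      size E b M               ≡⟨ size≡Σ² M ⟩
      Σ² (λ i j → ⟦ M i j ⟧)   ≡⟨ Σ²-cong M-weight ⟩
      Σ² (weight M)            ≡⟨ Σ²-weight M ⟩
      sumFin (λ i → wA i * deg M (inj₁ i)) + sumFin (λ j → wB j * deg M (inj₂ j)) + Σ² uncovered
                               ≡⟨ cong (_+ Σ² uncovered) (cong₂ _+_ (sumFin-cong A-tight) (sumFin-cong B-tight)) ⟩
      capacity                 ∎
      where
      open ≡-Reasoning
      A-tight : ∀ i → wA i * deg M (inj₁ i) ≡ wA i * b (inj₁ i)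
      A-tight i with S? (inj₁ i)
      ... | yes i∈S = cong (1 *_) (≤-antisym (deg≤b (inj₁ i)) (A-saturated i i∈S))
      ... | no _ = refl
      B-tight : ∀ j → wB j * deg M (inj₂ j) ≡ wB j * b (inj₂ j)
      B-tight j with S? (inj₂ j)
      ... | yes _ = refl
      ... | no j∉S = cong (1 *_) (≤-antisym (deg≤b (inj₂ j)) (B-saturated j j∉S))

    cover : ∀ N → IsBMatching E b N →
      size E b N + Σ² (doubly-covered N) + Σ² (uncovered-missed N) ≤ size E b M
    cover N (N⊆E , N-degA , N-degB) = begin
      size E b N + Σ² (doubly-covered N) + Σ² (uncovered-missed N)
        ≡⟨ cong (λ s → s + Σ² (doubly-covered N) + Σ² (uncovered-missed N)) (size≡Σ² N) ⟩
      Σ² (λ i j → ⟦ N i j ⟧) + Σ² (doubly-covered N) + Σ² (uncovered-missed N)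
        ≡⟨ trans (Σ²-+ (λ i j → ⟦ N i j ⟧ + doubly-covered N i j) (uncovered-missed N))
                (cong (_+ Σ² (uncovered-missed N)) (Σ²-+ (λ i j → ⟦ N i j ⟧) (doubly-covered N))) ⟨
      Σ² (λ i j → ⟦ N i j ⟧ + doubly-covered N i j + uncovered-missed N i j)
        ≤⟨ Σ²-mono (edge≤weight N N⊆E) ⟩
      Σ² (weight N)
        ≡⟨ Σ²-weight N ⟩
      sumFin (λ i → wA i * deg N (inj₁ i)) + sumFin (λ j → wB j * deg N (inj₂ j)) + Σ² uncovered
        ≤⟨ +-monoˡ-≤ (Σ² uncovered) (+-mono-≤ (sumFin-mono (λ i → *-monoʳ-≤ (wA i) (N-degA i)))
                                                (sumFin-mono (λ j → *-monoʳ-≤ (wB j) (N-degB j)))) ⟩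
      capacity
        ≡⟨ M-size ⟨
      size E b M ∎
      where open ≤-Reasoning

    size≤ : ∀ N → IsBMatching E b N → size E b N ≤ size E b M
    size≤ N N-bmatching = ≤-trans (≤-trans (m≤m+n _ _) (m≤m+n _ _)) (cover N N-bmatching)

    no-slack : ∀ N → IsBMatching E b N → size E b M ≤ size E b N →
      ∀ i j → doubly-covered N i j + uncovered-missed N i j ≤ 0
    no-slack N N-bmatching M≤N i j = +-cancelˡ-≤ (size E b N) _ _ (begin
      size E b N + (doubly-covered N i j + uncovered-missed N i j)
        ≤⟨ +-monoʳ-≤ (size E b N) (+-mono-≤ (≤Σ² _ i j) (≤Σ² _ i j)) ⟩
      size E b N + (Σ² (doubly-covered N) + Σ² (uncovered-missed N))
        ≡⟨ +-assoc (size E b N) _ _ ⟨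
      size E b N + Σ² (doubly-covered N) + Σ² (uncovered-missed N)
        ≤⟨ cover N N-bmatching ⟩
      size E b M
        ≤⟨ M≤N ⟩
      size E b N
        ≡⟨ +-identityʳ _ ⟨
      size E b N + 0 ∎)
      where open ≤-Reasoning

    matched-kept : ∀ N → IsBMatching E b N → size E b M ≤ size E b N →
      ∀ {i j} → M i j ≡ true → ¬ S (inj₁ i) → S (inj₂ j) → N i j ≡ true
    matched-kept N N-bmatching M≤N {i} {j} eM i∉S j∈S with N i j in eN
    ... | true = refl
    ... | false = ⊥-elim (1+n≰n (≤-trans (m≤n+m 1 (doubly-covered N i j))
                             (subst (λ n → doubly-covered N i j + n ≤ 0) missed (no-slack N N-bmatching M≤N i j))))
      where
      missed : uncovered-missed N i j ≡ 1
      missed rewrite eM | dec-false (S? (inj₁ i)) i∉S | dec-true (S? (inj₂ j)) j∈S | eN = refl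

    crossing-avoided : ∀ N → IsBMatching E b N → size E b M ≤ size E b N →
      ∀ {i j} → S (inj₁ i) → ¬ S (inj₂ j) → N i j ≢ true
    crossing-avoided N N-bmatching M≤N {i} {j} i∈S j∉S eN =
      1+n≰n (≤-trans (m≤m+n 1 (uncovered-missed N i j))
                     (subst (λ n → n + uncovered-missed N i j ≤ 0) doubly (no-slack N N-bmatching M≤N i j)))
      where
      doubly : doubly-covered N i j ≡ 1
      doubly rewrite eN | dec-true (S? (inj₁ i)) i∈S | dec-false (S? (inj₂ j)) j∉S = refl

  FromDeficientB-◅◅ : ∀ {v w} → FromDeficientB v → Reach v w → FromDeficientB w
  FromDeficientB-◅◅ (x , x-deficient , x⇝v) v⇝w = x , x-deficient , x⇝v ◅◅ v⇝w

  B-saturated-outside : ∀ j → ¬ FromDeficientB (inj₂ j) → b (inj₂ j) ≤ deg M (inj₂ j)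
  B-saturated-outside j j∉S = ≮⇒≥ (λ j-deficient → j∉S (inj₂ j , j-deficient , ε))

  noAugmentingPath⇒maximum : ¬ AugmentingPath → ∀ N → IsBMatching E b N → size E b N ≤ size E b M
  noAugmentingPath⇒maximum no-path = size≤
    where
    A-saturated : ∀ i → FromDeficientB (inj₁ i) → b (inj₁ i) ≤ deg M (inj₁ i)
    A-saturated i i∈S = ≮⇒≥ (λ i-deficient → no-path (inj₁ i , i∈S , inj₁ i , i-deficient , ε))
    open Cover FromDeficientB fromDeficientB? (λ a v∈S → FromDeficientB-◅◅ v∈S (a ◅ ε))
      A-saturated B-saturated-outside

maximumBMatching : ∀ {p q} (E : EdgeSet p q) (b : Vertex p q → ℕ) → ∃ (IsMaxBMatching E b)
maximumBMatching {p} {q} E b = search (p * q) (λ _ _ → false) empty-bmatching (m≤n+m (p * q) _)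
  where
  count-false : ∀ {n} → count {n} (λ _ → false) ≡ 0
  count-false {zero} = refl
  count-false {suc n} = count-false {n}

  empty-bmatching : IsBMatching E b (λ _ _ → false)
  empty-bmatching = (λ _ _ ()) , (λ i → subst (_≤ b (inj₁ i)) (sym (count-false {q})) z≤n)
                               , (λ j → subst (_≤ b (inj₂ j)) (sym (count-false {p})) z≤n)

  size≤pq : ∀ N → size E b N ≤ p * q
  size≤pq N = sumFin≤ q (λ i → count (N i)) (λ i → count≤n (N i))

  search : ∀ fuel M → IsBMatching E b M → p * q ≤ size E b M + fuel → ∃ (IsMaxBMatching E b)
  search fuel M M-bmatching bound with WithBMatching.augmentingPath? E b M M-bmatching
  ... | no no-path = M , M-bmatching , WithBMatching.noAugmentingPath⇒maximum E b M M-bmatching no-path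
  ... | yes path with WithBMatching.augment E b M M-bmatching path | fuel
  ... | N , _ , M<N | zero =
    ⊥-elim (<⇒≱ M<N (≤-trans (size≤pq N) (subst (p * q ≤_) (+-identityʳ _) bound)))
  ... | N , N-bmatching , M<N | suc fuel′ =
    search fuel′ N N-bmatching (≤-trans bound (≤-trans (≤-reflexive (+-suc _ fuel′)) (+-monoˡ-≤ fuel′ M<N)))

SameComp-sym : ∀ {p q} {E : EdgeSet p q} {b} {x y} → SameComp E b x y → SameComp E b y x
SameComp-sym {E = E} {b} = reverse flexAdj-sym
  where
  flexAdj-sym : ∀ {x y} → FlexAdj E b x y → FlexAdj E b y x
  flexAdj-sym {inj₁ _} {inj₂ _} flexible = flexible
  flexAdj-sym {inj₂ _} {inj₁ _} flexible = flexible

module WithMaximumBMatching {p q : ℕ} (E : EdgeSet p q) (b : Vertex p q → ℕ) (M : EdgeSet p q)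
  (M-maximum : IsMaxBMatching E b M) where

  open WithBMatching E b M (proj₁ M-maximum) public

  ZeroA ZeroB : Vertex p q → Set
  ZeroA (inj₁ i) = b (inj₁ i) ≡ 0
  ZeroA (inj₂ _) = ⊥
  ZeroB (inj₁ _) = ⊥
  ZeroB (inj₂ j) = b (inj₂ j) ≡ 0

  no-augmenting-path : ¬ AugmentingPath
  no-augmenting-path path with augment path
  ... | N , N-bmatching , M<N = <⇒≱ M<N (proj₂ M-maximum N N-bmatching)

  fromDeficientB⇒saturated : ∀ {i} → FromDeficientB (inj₁ i) → ¬ Deficient (inj₁ i)
  fromDeficientB⇒saturated i∈R i-deficient = no-augmenting-path (_ , i∈R , _ , i-deficient , ε)

  toDeficientA⇒saturated : ∀ {j} → ToDeficientA (inj₂ j) → ¬ Deficient (inj₂ j)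
  toDeficientA⇒saturated j∈R j-deficient = no-augmenting-path (_ , (_ , j-deficient , ε) , j∈R)

  matched-partnerA : ∀ i → ¬ Deficient (inj₁ i) → b (inj₁ i) ≢ 0 → ∃ λ j → M i j ≡ true
  matched-partnerA i saturated b≢0 = count>0⇒∃ (M i) (<-≤-trans (n≢0⇒n>0 b≢0) (≮⇒≥ saturated))

  matched-partnerB : ∀ j → ¬ Deficient (inj₂ j) → b (inj₂ j) ≢ 0 → ∃ λ i → M i j ≡ true
  matched-partnerB j saturated b≢0 = count>0⇒∃ (λ i → M i j) (<-≤-trans (n≢0⇒n>0 b≢0) (≮⇒≥ saturated))

  flip-maximum : ∀ {x y} (T : Trail x y) → x ≡ y ⊎ (Source x × Sink y) → inA x ≡ inA y →
    IsMaxBMatching E b (flip T)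
  flip-maximum {x} T ends same-side =
    flip-bmatching T ends , λ N N-bmatching → ≤-trans (proj₂ M-maximum N N-bmatching) (≤-reflexive (sym same-size))
    where
    same-size : size E b (flip T) ≡ size E b M
    same-size = +-cancelʳ-≡ (inA x) _ _ (trans (flip-size T) (cong (size E b M +_) (sym same-side)))

  used⇒flexible : ∀ {x y} (T : Trail x y) → x ≡ y ⊎ (Source x × Sink y) → inA x ≡ inA y →
    ∀ {i j} → Uses i j T → Flexible E b i j
  used⇒flexible T ends same-side {i} {j} used with M i j in eM
  ... | true = (M⊆E i j eM , M , M-maximum , eM) , λ inevitable →
    true≢false (trans (sym (proj₂ inevitable (flip T) (flip-maximum T ends same-side)))
                      (trans (flip-used T used) (cong not eM)))
  ... | false = (flip-⊆ M⊆E T i j flipped , flip T , flip-maximum T ends same-side , flipped) , λ inevitable →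
    true≢false (trans (sym (proj₂ inevitable M M-maximum)) eM)
    where
    flipped : flip T i j ≡ true
    flipped = trans (flip-used T used) (cong not eM)

  closing-arc⇒flexible : ∀ {w z} (a : Arc w z) → Reach z w → Flexible E b (arcA a) (arcB a)
  closing-arc⇒flexible a z⇝w =
    used⇒flexible (cons a P (closing-arc-fresh a P P-simple)) (inj₁ refl) refl (inj₁ (refl , refl))
    where
    P : Trail _ _
    P = proj₁ (simplify z⇝w)
    P-simple : Simple P
    P-simple = proj₂ (simplify z⇝w)

  -- Flipping T extended by a, and then, if that stops in A, by a matched edge at the
  -- (necessarily saturated) end, gives another maximum b-matching.
  append⇒flexible : ∀ {x w z} → DeficientB x → (T : Trail x w) (a : Arc w z) → ¬ z ∈ᵛ T →
    ¬ ZeroA z → Flexible E b (arcA a) (arcB a)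
  append⇒flexible {inj₂ _} x-deficient T a@(matched _ _) z∉T _ =
    used⇒flexible (T ++ last ∣ disjoint) (inj₂ (x-deficient , tt)) refl (uses-++ʳ T last disjoint (inj₁ (refl , refl)))
    where
    last : Trail _ _
    last = cons a [] (λ ())
    disjoint : Disjoint T last
    disjoint u (inj₁ (refl , refl)) = z∉T (proj₂ (uses⇒∈ᵛ T u))
  append⇒flexible {inj₂ _} x-deficient T a@(unmatched {i} {j} _ m) i∉T b≢0 =
    used⇒flexible (T ++ tail ∣ disjoint) (inj₂ (x-deficient , tt)) refl (uses-++ʳ T tail disjoint (inj₁ (refl , refl)))
    where
    partner : ∃ λ j′ → M i j′ ≡ true
    partner = matched-partnerA i (fromDeficientB⇒saturated (_ , x-deficient , toReach T ◅◅ (a ◅ ε))) b≢0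
    j′ : Fin q
    j′ = proj₁ partner
    m′ : M i j′ ≡ true
    m′ = proj₂ partner
    tail : Trail (inj₂ j) (inj₂ j′)
    tail = cons a (cons (matched (M⊆E i j′ m′) m′) [] (λ ()))
                  (λ { (inj₁ (_ , j≡j′)) → true≢false (trans (sym m′) (subst (λ k → M i k ≡ false) j≡j′ m)) })
    disjoint : Disjoint T tail
    disjoint u (inj₁ (refl , _)) = i∉T (proj₁ (uses⇒∈ᵛ T u))
    disjoint u (inj₂ (inj₁ (refl , _))) = i∉T (proj₁ (uses⇒∈ᵛ T u))

  fromDeficientB⇒flexible : ∀ {w z} (a : Arc w z) → FromDeficientB w → ¬ ZeroA z → Flexible E b (arcA a) (arcB a)
  fromDeficientB⇒flexible {w} {z} a (x , x-deficient , x⇝w) z-nonzero with Reach? z w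
  ... | yes z⇝w = closing-arc⇒flexible a z⇝w
  ... | no ¬z⇝w = append⇒flexible x-deficient T a (λ z∈T → ¬z⇝w (∈ᵛ-reach T z∈T)) z-nonzero
    where
    T : Trail _ w
    T = proj₁ (simplify x⇝w)

  prepend⇒flexible : ∀ {w z y} → DeficientA y → (T : Trail z y) (a : Arc w z) → ¬ w ∈ᵛ T →
    ¬ ZeroB w → Flexible E b (arcA a) (arcB a)
  prepend⇒flexible {y = inj₁ _} y-deficient T a@(matched _ _) w∉T _ =
    used⇒flexible (cons a T (fresh-arc a T w∉T)) (inj₂ (tt , y-deficient)) refl (inj₁ (refl , refl))
  prepend⇒flexible {y = inj₁ _} y-deficient T a@(unmatched {i} {j} _ m) j∉T b≢0 =
    used⇒flexible (cons (matched (M⊆E i′ j m′) m′) rest fresh) (inj₂ (tt , y-deficient)) refl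
      (inj₂ (inj₁ (refl , refl)))
    where
    partner : ∃ λ i′ → M i′ j ≡ true
    partner = matched-partnerB j (toDeficientA⇒saturated (_ , y-deficient , a ◅ toReach T)) b≢0
    i′ : Fin p
    i′ = proj₁ partner
    m′ : M i′ j ≡ true
    m′ = proj₂ partner
    rest : Trail (inj₂ j) _
    rest = cons a T (fresh-arc a T j∉T)
    fresh : ¬ Uses i′ j rest
    fresh (inj₁ (i′≡i , _)) = true≢false (trans (sym m′) (subst (λ k → M k j ≡ false) (sym i′≡i) m))
    fresh (inj₂ u) = j∉T (proj₂ (uses⇒∈ᵛ T u))

  toDeficientA⇒flexible : ∀ {w z} (a : Arc w z) → ToDeficientA z → ¬ ZeroB w → Flexible E b (arcA a) (arcB a)
  toDeficientA⇒flexible {w} {z} a (y , y-deficient , z⇝y) w-nonzero with Reach? z w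
  ... | yes z⇝w = closing-arc⇒flexible a z⇝w
  ... | no ¬z⇝w = prepend⇒flexible y-deficient T a (λ w∈T → ¬z⇝w (reach-∈ᵛ T w∈T)) w-nonzero
    where
    T : Trail z _
    T = proj₁ (simplify z⇝y)

  -- The vertices reachable from v or from a deficient B-vertex form a set S as in `Cover`;
  -- an arc leaving the complement of S into S is then fixed by every maximum b-matching.
  rigid-arc : ∀ {u v} (a : Arc u v) → ¬ Reach v u → ¬ FromDeficientB u → ¬ ToDeficientA v →
    ¬ Flexible E b (arcA a) (arcB a)
  rigid-arc {u} {v} a ¬v⇝u u∉R v∉R = kept-or-avoided a
    where
    S : Vertex p q → Set
    S w = Reach v w ⊎ FromDeficientB w

    S-closed : ∀ {w w′} → Arc w w′ → S w → S w′
    S-closed a′ (inj₁ v⇝w) = inj₁ (v⇝w ◅◅ (a′ ◅ ε))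
    S-closed a′ (inj₂ w∈R) = inj₂ (FromDeficientB-◅◅ w∈R (a′ ◅ ε))

    A-saturated : ∀ i → S (inj₁ i) → b (inj₁ i) ≤ deg M (inj₁ i)
    A-saturated i i∈S = ≮⇒≥ λ i-deficient →
      [ (λ v⇝i → v∉R (inj₁ i , i-deficient , v⇝i)) , (λ i∈R → fromDeficientB⇒saturated i∈R i-deficient) ] i∈S

    open Cover S (λ w → Reach? v w ⊎-dec fromDeficientB? w) S-closed A-saturated
      (λ j j∉S → B-saturated-outside j (λ j∈R → j∉S (inj₂ j∈R)))

    M≤ : ∀ N → IsMaxBMatching E b N → size E b M ≤ size E b N
    M≤ N N-maximum = proj₂ N-maximum M (proj₁ M-maximum)

    kept-or-avoided : (a′ : Arc u v) → ¬ Flexible E b (arcA a′) (arcB a′)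
    kept-or-avoided (matched _ m) (allowed , not-inevitable) =
      not-inevitable (allowed , λ N N-maximum →
        matched-kept N (proj₁ N-maximum) (M≤ N N-maximum) m [ ¬v⇝u , u∉R ] (inj₁ ε))
    kept-or-avoided (unmatched _ _) ((_ , N , N-maximum , eN) , _) =
      crossing-avoided N (proj₁ N-maximum) (M≤ N N-maximum) (inj₁ ε) [ ¬v⇝u , u∉R ] eN

  flexible-arc-cases : ∀ {u v} (a : Arc u v) → Flexible E b (arcA a) (arcB a) →
    Reach v u ⊎ FromDeficientB u ⊎ ToDeficientA v
  flexible-arc-cases {u} {v} a flexible with Reach? v u | fromDeficientB? u | toDeficientA? v
  ... | yes v⇝u | _ | _ = inj₁ v⇝u
  ... | no _ | yes u∈R | _ = inj₂ (inj₁ u∈R)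
  ... | no _ | no _ | yes v∈R = inj₂ (inj₂ v∈R)
  ... | no ¬v⇝u | no u∉R | no v∉R = ⊥-elim (rigid-arc a ¬v⇝u u∉R v∉R flexible)

  no-arc-into-ZeroB : ∀ {x y} → ZeroB y → ¬ Arc x y
  no-arc-into-ZeroB b≡0 (matched _ m) =
    n>0⇒n≢0 (proj₂ (bmatching-edge⇒capacities>0 {b = b} (proj₁ M-maximum) m)) b≡0

  no-arc-from-ZeroA : ∀ {x y} → ZeroA x → ¬ Arc x y
  no-arc-from-ZeroA b≡0 (matched _ m) =
    n>0⇒n≢0 (proj₁ (bmatching-edge⇒capacities>0 {b = b} (proj₁ M-maximum) m)) b≡0

  reach-into-ZeroB : ∀ {x y} → ZeroB y → Reach x y → x ≡ y
  reach-into-ZeroB _ ε = refl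
  reach-into-ZeroB y-zero (a ◅ r) with reach-into-ZeroB y-zero r
  ... | refl = ⊥-elim (no-arc-into-ZeroB y-zero a)

  reach-from-ZeroA : ∀ {x y} → ZeroA x → Reach x y → x ≡ y
  reach-from-ZeroA _ ε = refl
  reach-from-ZeroA x-zero (a ◅ _) = ⊥-elim (no-arc-from-ZeroA x-zero a)

  ZeroA⇒¬ZeroB : ∀ x → ZeroA x → ¬ ZeroB x
  ZeroA⇒¬ZeroB (inj₁ _) _ ()

  ZeroA⇒¬ToDeficientA : ∀ {x} → ZeroA x → ¬ ToDeficientA x
  ZeroA⇒¬ToDeficientA x-zero (inj₁ _ , y-deficient , x⇝y) with reach-from-ZeroA x-zero x⇝y
  ... | refl = n≮0 (subst (_ <_) x-zero y-deficient)

  ZeroB⇒¬FromDeficientB : ∀ {y} → ZeroB y → ¬ FromDeficientB y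
  ZeroB⇒¬FromDeficientB y-zero (inj₂ _ , x-deficient , x⇝y) with reach-into-ZeroB y-zero x⇝y
  ... | refl = n≮0 (subst (_ <_) y-zero x-deficient)

  -- The Dulmage–Mendelsohn order; `low` and `high` never meet at a vertex, since M has no
  -- augmenting path.
  data _⊑_ (x y : Vertex p q) : Set where
    bottom : ZeroB x → x ⊑ y
    top    : ZeroA y → x ⊑ y
    low    : ToDeficientA x → ¬ ZeroB y → x ⊑ y
    high   : FromDeficientB y → ¬ ZeroA x → x ⊑ y
    reach  : Reach x y → x ⊑ y

  ⊑-trans : ∀ {x y z} → x ⊑ y → y ⊑ z → x ⊑ z
  ⊑-trans (bottom x-zero) _ = bottom x-zero
  ⊑-trans _ (top z-zero) = top z-zero
  ⊑-trans {y = y} (top y-zero) (bottom y-zero′) = ⊥-elim (ZeroA⇒¬ZeroB y y-zero y-zero′)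
  ⊑-trans (top y-zero) (low y∈R _) = ⊥-elim (ZeroA⇒¬ToDeficientA y-zero y∈R)
  ⊑-trans (top y-zero) (high _ y-nonzero) = ⊥-elim (y-nonzero y-zero)
  ⊑-trans (top y-zero) (reach y⇝z) = top (subst ZeroA (reach-from-ZeroA y-zero y⇝z) y-zero)
  ⊑-trans (low _ y-nonzero) (bottom y-zero) = ⊥-elim (y-nonzero y-zero)
  ⊑-trans (low x∈R _) (low _ z-nonzero) = low x∈R z-nonzero
  ⊑-trans (low x∈R _) (high z∈R _) = low x∈R (λ z-zero → ZeroB⇒¬FromDeficientB z-zero z∈R)
  ⊑-trans (low x∈R y-nonzero) (reach y⇝z) =
    low x∈R (λ z-zero → y-nonzero (subst ZeroB (sym (reach-into-ZeroB z-zero y⇝z)) z-zero))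
  ⊑-trans (high y∈R _) (bottom y-zero) = ⊥-elim (ZeroB⇒¬FromDeficientB y-zero y∈R)
  ⊑-trans (high y∈R _) (low y∈R′ _) = ⊥-elim (no-augmenting-path (_ , y∈R , y∈R′))
  ⊑-trans (high _ x-nonzero) (high z∈R _) = high z∈R x-nonzero
  ⊑-trans (high y∈R x-nonzero) (reach y⇝z) = high (FromDeficientB-◅◅ y∈R y⇝z) x-nonzero
  ⊑-trans (reach x⇝y) (bottom y-zero) = bottom (subst ZeroB (sym (reach-into-ZeroB y-zero x⇝y)) y-zero)
  ⊑-trans (reach x⇝y) (low (w , w-deficient , y⇝w) z-nonzero) = low (w , w-deficient , x⇝y ◅◅ y⇝w) z-nonzero
  ⊑-trans (reach x⇝y) (high z∈R y-nonzero) =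
    high z∈R (λ x-zero → y-nonzero (subst ZeroA (reach-from-ZeroA x-zero x⇝y) x-zero))
  ⊑-trans (reach x⇝y) (reach y⇝z) = reach (x⇝y ◅◅ y⇝z)

  rigid-arc⇒¬⊒ : ∀ {w z} (a : Arc w z) → ¬ Flexible E b (arcA a) (arcB a) → ¬ z ⊑ w
  rigid-arc⇒¬⊒ a _ (bottom z-zero) = no-arc-into-ZeroB z-zero a
  rigid-arc⇒¬⊒ a _ (top w-zero) = no-arc-from-ZeroA w-zero a
  rigid-arc⇒¬⊒ a rigid (low z∈R w-nonzero) = rigid (toDeficientA⇒flexible a z∈R w-nonzero)
  rigid-arc⇒¬⊒ a rigid (high w∈R z-nonzero) = rigid (fromDeficientB⇒flexible a w∈R z-nonzero)
  rigid-arc⇒¬⊒ a rigid (reach z⇝w) = rigid (closing-arc⇒flexible a z⇝w)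

  flexible⇒⊑ : ∀ {i j} → Flexible E b i j → inj₁ i ⊑ inj₂ j × inj₂ j ⊑ inj₁ i
  flexible⇒⊑ {i} {j} flexible with M i j in eM
  ... | true = reach (a ◅ ε) , [ reach , [ (λ i∈R → high i∈R (λ ())) , (λ j∈R → low j∈R (λ ())) ] ]
                                   (flexible-arc-cases a flexible)
    where
    a : Arc (inj₁ i) (inj₂ j)
    a = matched (M⊆E i j eM) eM
  ... | false = [ reach , [ (λ j∈R → high j∈R (n>0⇒n≢0 (proj₁ capacities>0)))
                          , (λ i∈R → low i∈R (n>0⇒n≢0 (proj₂ capacities>0))) ] ]
                  (flexible-arc-cases a flexible) , reach (a ◅ ε)
    where
    a : Arc (inj₂ j) (inj₁ i)
    a = unmatched (proj₁ (proj₁ flexible)) eM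
    capacities>0 : 0 < b (inj₁ i) × 0 < b (inj₂ j)
    capacities>0 = allowed⇒capacities>0 {b = b} (proj₁ flexible)

  flexAdj⇒⊑ : ∀ {x y} → FlexAdj E b x y → x ⊑ y
  flexAdj⇒⊑ {inj₁ _} {inj₂ _} flexible = proj₁ (flexible⇒⊑ flexible)
  flexAdj⇒⊑ {inj₂ _} {inj₁ _} flexible = proj₂ (flexible⇒⊑ flexible)

  sameComp⇒⊑ : ∀ {x y} → SameComp E b x y → x ⊑ y
  sameComp⇒⊑ ε = reach ε
  sameComp⇒⊑ (adj ◅ rest) = ⊑-trans (flexAdj⇒⊑ adj) (sameComp⇒⊑ rest)

  _⊏_ : Vertex p q → Vertex p q → Set
  x ⊏ y = x ⊑ y × ¬ y ⊑ x

  rigid-arc⇒⊏ : ∀ {w z x y} (a : Arc w z) → ¬ Flexible E b (arcA a) (arcB a) →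
    SameComp E b x w → SameComp E b y z → x ⊏ y
  rigid-arc⇒⊏ a rigid x~w y~z =
    ⊑-trans (sameComp⇒⊑ x~w) (⊑-trans (reach (a ◅ ε)) (sameComp⇒⊑ (SameComp-sym y~z))) ,
    λ y⊑x → rigid-arc⇒¬⊒ a rigid (⊑-trans (sameComp⇒⊑ (SameComp-sym y~z)) (⊑-trans y⊑x (sameComp⇒⊑ x~w)))

  stepA⇒same⊎⊏ : ∀ {x y} → StepA E b x y → SameComp E b x y ⊎ x ⊏ y
  stepA⇒same⊎⊏ (inj₁ x~y) = inj₁ x~y
  stepA⇒same⊎⊏ (inj₂ (inj₁ (i , j , inevitable , x~i , y~j))) =
    inj₂ (rigid-arc⇒⊏ (matched (proj₁ (proj₁ inevitable)) (proj₂ inevitable M M-maximum))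
                      (λ flexible → proj₂ flexible inevitable) x~i y~j)
  stepA⇒same⊎⊏ (inj₂ (inj₂ (i , j , forbidden , y~i , x~j))) with M i j in eM
  ... | true = ⊥-elim (proj₂ forbidden (proj₁ forbidden , M , M-maximum , eM))
  ... | false =
    inj₂ (rigid-arc⇒⊏ (unmatched (proj₁ forbidden) eM) (λ flexible → proj₂ forbidden (proj₁ flexible)) x~j y~i)

  LeA⇒same⊎⊏ : ∀ {x y} → LeA E b x y → SameComp E b x y ⊎ x ⊏ y
  LeA⇒same⊎⊏ ε = inj₁ ε
  LeA⇒same⊎⊏ (step ◅ steps) = combine (stepA⇒same⊎⊏ step) (LeA⇒same⊎⊏ steps)
    where
    combine : ∀ {x y z} → SameComp E b x y ⊎ x ⊏ y → SameComp E b y z ⊎ y ⊏ z → SameComp E b x z ⊎ x ⊏ z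
    combine (inj₁ x~y) (inj₁ y~z) = inj₁ (x~y ◅◅ y~z)
    combine (inj₁ x~y) (inj₂ (y⊑z , z⋢y)) =
      inj₂ (⊑-trans (sameComp⇒⊑ x~y) y⊑z , λ z⊑x → z⋢y (⊑-trans z⊑x (sameComp⇒⊑ x~y)))
    combine (inj₂ (x⊑y , y⋢x)) (inj₁ y~z) =
      inj₂ (⊑-trans x⊑y (sameComp⇒⊑ y~z) , λ z⊑x → y⋢x (⊑-trans (sameComp⇒⊑ y~z) z⊑x))
    combine (inj₂ (x⊑y , y⋢x)) (inj₂ (y⊑z , _)) =
      inj₂ (⊑-trans x⊑y y⊑z , λ z⊑x → y⋢x (⊑-trans y⊑z z⊑x))

  LeA-antisym : ∀ {x y} → LeA E b x y → LeA E b y x → SameComp E b x y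
  LeA-antisym x≤y y≤x with LeA⇒same⊎⊏ x≤y | LeA⇒same⊎⊏ y≤x
  ... | inj₁ x~y | _ = x~y
  ... | inj₂ _ | inj₁ y~x = SameComp-sym y~x
  ... | inj₂ (_ , y⋢x) | inj₂ (y⊑x , _) = ⊥-elim (y⋢x y⊑x)

mainTheorem4 : (p q : ℕ) (E : EdgeSet p q) (b : Vertex p q → ℕ) →
               IsPartialOrder (SameComp E b) (LeA E b)
mainTheorem4 p q E b = record
  { isPreorder = record
    { isEquivalence = record { refl = ε ; sym = SameComp-sym ; trans = _◅◅_ }
    ; reflexive = λ x~y → inj₁ x~y ◅ ε
    ; trans = _◅◅_
    }
  ; antisym = LeA-antisym
  }
  where
  open WithMaximumBMatching E b (proj₁ (maximumBMatching E b)) (proj₂ (maximumBMatching E b))
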